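{- Let $n \ge 3$ be an integer and let $G$ be a connected finite simple graph of order $n$. Then $\alpha_1'(G) \ge 2$, with equality if and only if $G$ is isomorphic to one of $C_3, C_4, D_4, K_4, U_{1,3}, P_4, K_{1,n-1}$.
   Context: For a graph $G$, a $1$-nearly edge independent set of $G$ is a set $M \subseteq E(G)$ such that $M$ contains exactly one (unordered) pair of distinct edges that are adjacent in $G$ (i.e. share a common end vertex). The $1$-nearly edge independence number $\alpha_1'(G)$ is the maximum cardinality of a $1$-nearly edge independent set of $G$, taken to be $0$ if $G$ has no such set. $C_m$, $P_m$, $K_m$ denote the cycle, path and complete graph on $m$ vertices; $K_{1,n-1}$ is the star on $n$ vertices; $D_4 = K_4 - e$ (the diamond) is $K_4$ with one edge removed; $U_{1,3}$ is the graph obtained from the star $K_{1,3}$ by adding one edge (between two leaves), making it unicyclic. -}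

module Defs where

open import Data.Nat using (ℕ; zero; suc; _<_; _≤_)
open import Data.Bool using (Bool; true; false; _∧_; _∨_; not)
open import Data.Bool.Properties using (∨-comm)
open import Data.Fin using (Fin; zero; suc)
open import Data.Fin using (#_)
open import Data.Fin.Properties using (_≟_)
import Data.Fin as F
open import Data.List using (List; []; _∷_; map; length; allFin)
open import Data.Bool.ListAction using (any)
open import Data.List.Membership.Propositional using (_∈_)
open import Data.List.Relation.Unary.Unique.Propositional using (Unique)
open import Data.Product using (Σ; ∃; _×_; _,_; proj₁; proj₂)
open import Data.Sum using (_⊎_)
open import Relation.Nullary using (¬_; yes; no)
open import Relation.Nullary.Decidable using (⌊_⌋)
open import Relation.Binary.PropositionalEquality using (_≡_; refl; sym)
open import Function.Bundles using (_↔_; Inverse)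

record Graph (n : ℕ) : Set where
  field
    adj     : Fin n → Fin n → Bool
    adj-sym : ∀ i j → adj i j ≡ adj j i
    irrefl  : ∀ i → adj i i ≡ false
open Graph public

private
  eqF : ∀ {n} → Fin n → Fin n → Bool
  eqF i j = ⌊ i ≟ j ⌋

  memE : ∀ {n} → Fin n → Fin n → List (Fin n × Fin n) → Bool
  memE i j es = any (λ e → eqF i (proj₁ e) ∧ eqF j (proj₂ e)) es

  adjE : ∀ {n} → List (Fin n × Fin n) → Fin n → Fin n → Bool
  adjE es i j = not (eqF i j) ∧ (memE i j es ∨ memE j i es)

  eqF-sym : ∀ {n} (i j : Fin n) → eqF i j ≡ eqF j i
  eqF-sym i j with i ≟ j | j ≟ i
  ... | yes _ | yes _ = refl
  ... | no _  | no _  = refl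
  ... | yes p | no q  with q (sym p)
  ... | ()
  eqF-sym i j | no q | yes p with q (sym p)
  ... | ()

  eqF-refl : ∀ {n} (i : Fin n) → eqF i i ≡ true
  eqF-refl i with i ≟ i
  ... | yes _ = refl
  ... | no q with q refl
  ... | ()

  adjE-sym : ∀ {n} (es : List (Fin n × Fin n)) i j → adjE es i j ≡ adjE es j i
  adjE-sym es i j rewrite eqF-sym i j | ∨-comm (memE i j es) (memE j i es) = refl

  adjE-irr : ∀ {n} (es : List (Fin n × Fin n)) i → adjE es i i ≡ false
  adjE-irr es i rewrite eqF-refl i = refl

fromEdges : ∀ {n} → List (Fin n × Fin n) → Graph n
fromEdges es = record { adj = adjE es ; adj-sym = adjE-sym es ; irrefl = adjE-irr es }

data Reach {n} (G : Graph n) : Fin n → Fin n → Set where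
  here : ∀ {u} → Reach G u u
  step : ∀ {u v w} → adj G u v ≡ true → Reach G v w → Reach G u w

Connected : ∀ {n} → Graph n → Set
Connected {n} G = ∀ (u v : Fin n) → Reach G u v

Iso : ∀ {n m} → Graph n → Graph m → Set
Iso {n} {m} G H =
  Σ (Fin n ↔ Fin m) λ f → ∀ i j → adj G i j ≡ adj H (Inverse.to f i) (Inverse.to f j)

-- Edges and 1-nearly edge independent sets.
-- An edge is represented canonically as (i , j) with i < j and i ~ j.

Edge : ∀ {n} → Graph n → Set
Edge {n} G = Σ (Fin n × Fin n) λ p → (proj₁ p F.< proj₂ p) × (adj G (proj₁ p) (proj₂ p) ≡ true)

module _ {n : ℕ} (G : Graph n) where

  ends : Edge G → Fin n × Fin n
  ends = proj₁

  IsEnd : Fin n → Edge G → Set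
  IsEnd v e = (v ≡ proj₁ (ends e)) ⊎ (v ≡ proj₂ (ends e))

  AdjEdges : Edge G → Edge G → Set
  AdjEdges e f = ¬ (ends e ≡ ends f) × ∃ λ (v : Fin n) → IsEnd v e × IsEnd v f

  EdgeSet : Set
  EdgeSet = Σ (List (Edge G)) λ M → Unique (map ends M)

  OneNearlyIndep : EdgeSet → Set
  OneNearlyIndep M =
    Σ (Edge G) λ e → Σ (Edge G) λ f →
      e ∈ proj₁ M × f ∈ proj₁ M × AdjEdges e f ×
      (∀ g h → g ∈ proj₁ M → h ∈ proj₁ M → AdjEdges g h →
         (ends g ≡ ends e × ends h ≡ ends f) ⊎ (ends g ≡ ends f × ends h ≡ ends e))

-- k is the 1-nearly edge independence number α₁'(G):
-- the maximum size of a 1-nearly edge independent set, or 0 if none exists.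
IsAlpha1' : ∀ {n} → Graph n → ℕ → Set
IsAlpha1' G k =
  ((Σ (EdgeSet G) λ M → OneNearlyIndep G M × length (proj₁ M) ≡ k) ×
   (∀ (M : EdgeSet G) → OneNearlyIndep G M → length (proj₁ M) ≤ k))
  ⊎ ((∀ (M : EdgeSet G) → ¬ OneNearlyIndep G M) × k ≡ 0)

C₃ : Graph 3
C₃ = fromEdges ((# 0 , # 1) ∷ (# 1 , # 2) ∷ (# 2 , # 0) ∷ [])

C₄ : Graph 4
C₄ = fromEdges ((# 0 , # 1) ∷ (# 1 , # 2) ∷ (# 2 , # 3) ∷ (# 3 , # 0) ∷ [])

P₄ : Graph 4
P₄ = fromEdges ((# 0 , # 1) ∷ (# 1 , # 2) ∷ (# 2 , # 3) ∷ [])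

K₄ : Graph 4
K₄ = fromEdges ((# 0 , # 1) ∷ (# 0 , # 2) ∷ (# 0 , # 3) ∷ (# 1 , # 2) ∷ (# 1 , # 3) ∷ (# 2 , # 3) ∷ [])

-- diamond: K₄ minus the edge {2,3}
D₄ : Graph 4
D₄ = fromEdges ((# 0 , # 1) ∷ (# 0 , # 2) ∷ (# 0 , # 3) ∷ (# 1 , # 2) ∷ (# 1 , # 3) ∷ [])

-- star K_{1,3} with centre 0 plus the edge {1,2}
U₁₃ : Graph 4
U₁₃ = fromEdges ((# 0 , # 1) ∷ (# 0 , # 2) ∷ (# 0 , # 3) ∷ (# 1 , # 2) ∷ [])

Star : (n : ℕ) → Graph n
Star zero    = fromEdges []
Star (suc m) = fromEdges (map (λ i → (zero , suc i)) (allFin m))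

{-# OPTIONS --safe #-}
-- A 1-nearly edge independent set with at least three edges consists of two adjacent edges (a P₃)
-- and an edge disjoint from both, so α₁'(G) ≥ 3 exactly when G contains P₃ ∪ K₂; a connected graph
-- on n ≥ 3 vertices contains a P₃, so α₁'(G) ≥ 2.  A graph containing P₃ ∪ K₂ has at least five
-- vertices and two disjoint edges, hence it is neither one of the listed graphs on at most four
-- vertices nor a star.  Conversely, let G be connected without P₃ ∪ K₂.  For n ≤ 4, G is in the
-- list by exhaustive search.  For n ≥ 5, if some vertex meets every edge then G is a star.
-- Otherwise an edge uv, an edge avoiding u and an edge avoiding v give two disjoint edges or a
-- triangle, and a vertex outside them adjacent to one of them (it exists by connectivity, as
-- n ≥ 5) completes a P₃ ∪ K₂.
module Submission where

open import Defs
open import Data.Bool as Bool using (Bool; true; false; _∧_; _∨_)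
import Data.Bool.Properties as Bool
open import Data.Bool.ListAction using (any)
open import Data.Empty using (⊥; ⊥-elim)
open import Data.Fin using (Fin; zero; suc; #_)
open import Data.Fin.Properties
  using (_≟_; <-cmp; <-irrefl; <-asym; <⇒≢; all?; any?; injective⇒≤; ¬Fin0)
open import Data.Fin.Permutation as Perm using (Permutation′; _⟨$⟩ʳ_)
open import Data.Fin.Subset using (Subset; _∈_; _∉_)
open import Data.Fin.Subset.Properties using (_∈?_; anySubset?)
open import Data.List using (List; []; _∷_; map; length; allFin; concatMap; mapMaybe; head)
open import Data.List.Membership.Propositional using () renaming (_∈_ to _∈ₗ_)
open import Data.List.Membership.Propositional.Properties using (∈-map⁻; ∈-allFin)
open import Data.List.Properties using (length-map)
open import Data.List.Relation.Unary.All as All using (All; []; _∷_)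
import Data.List.Relation.Unary.All.Properties as All
open import Data.List.Relation.Unary.Any using (here; there)
open import Data.List.Relation.Unary.AllPairs using ([]; _∷_)
open import Data.List.Relation.Unary.Unique.Propositional using (Unique)
open import Data.Maybe as Maybe using (Maybe; nothing; _<∣>_; is-just; to-witness-T)
open import Data.Nat as ℕ using (ℕ; zero; suc; _+_; _≤_; _<_; z≤n; s≤s)
import Data.Nat.Properties as ℕ
open import Data.Product using (Σ; ∃; ∃₂; _×_; _,_; proj₁; proj₂)
open import Data.Product.Properties using (≡-dec)
open import Data.Sum as Sum using (_⊎_; inj₁; inj₂; [_,_]′)
open import Data.Unit using (⊤; tt)
open import Data.Vec using (lookup; tabulate)
open import Data.Vec.Properties using (lookup∘tabulate)
open import Data.Vec.Functional using (Vector) renaming ([] to []ᵛ; _∷_ to _∷ᵛ_)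
open import Function using (id; _∘_; _∘₂_; _$_; const; _↔_; Inverse; _⇔_; mk⇔; Injective)
open import Function.Construct.Symmetry using (↔-sym)
open import Function.Properties.Inverse using (↔⇒↣)
open import Function.Bundles using (Injection)
open import Relation.Binary.Definitions using (DecidableEquality; tri<; tri≈; tri>)
open import Relation.Binary.PropositionalEquality
  using (_≡_; _≢_; refl; sym; trans; cong; cong₂; subst; subst₂; ≢-sym)
open import Relation.Nullary using (¬_; Dec; yes; no; ¬?; contradiction)
open import Relation.Nullary.Decidable
  using (⌊_⌋; True; toWitness; dec⇒maybe; map′; decidable-stable; _×-dec_; _⊎-dec_; _→-dec_)
open import Relation.Unary using (Decidable)

private
  variable
    k m n : ℕ
    t u v x y z : Fin n

Disjoint : (G : Graph n) → Edge G → Edge G → Set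
Disjoint G e f = ∀ z → IsEnd G z e → IsEnd G z f → ⊥

record P₃ (G : Graph n) : Set where
  field
    e f : Edge G
    e~f : AdjEdges G e f

record P₃+K₂ (G : Graph n) : Set where
  field
    e f g : Edge G
    e~f   : AdjEdges G e f
    g∥e   : Disjoint G g e
    g∥f   : Disjoint G g f

  path : P₃ G
  path = record { e = e ; f = f ; e~f = e~f }

K₂+K₂ : Graph n → Set
K₂+K₂ G = Σ (Edge G) λ e₁ → Σ (Edge G) λ e₂ → Disjoint G e₁ e₂

record Triangle (G : Graph n) : Set where
  constructor triangle
  field
    {a b c} : Fin n
    ab : adj G a b ≡ true
    bc : adj G b c ≡ true
    ca : adj G c a ≡ true

MeetsEveryEdge : Graph n → Fin n → Set
MeetsEveryEdge G c = ∀ i j → adj G i j ≡ true → i ≡ c ⊎ j ≡ c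

AvoidingEdge : Graph n → Fin n → Set
AvoidingEdge G c = ∃₂ λ i j → adj G i j ≡ true × i ≢ c × j ≢ c

Dominating : Graph n → Fin n → Set
Dominating G c = ∀ j → j ≢ c → adj G c j ≡ true

OneNearlyIndepOfSize : Graph n → ℕ → Set
OneNearlyIndepOfSize G k = Σ (EdgeSet G) λ M → OneNearlyIndep G M × length (proj₁ M) ≡ k

Exceptional : Graph n → Set
Exceptional {n} G =
  Iso G C₃ ⊎ Iso G C₄ ⊎ Iso G D₄ ⊎ Iso G K₄ ⊎ Iso G U₁₃ ⊎ Iso G P₄ ⊎ Iso G (Star n)

module _ {A : Set} (_≟ᴬ_ : DecidableEquality A) where

  unique⇒avoids-two : ∀ {xs : List A} → Unique xs → 3 ≤ length xs →
                      ∀ p q → ∃ λ x → x ∈ₗ xs × x ≢ p × x ≢ q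
  unique⇒avoids-two {a ∷ b ∷ c ∷ _} ((a≢b ∷ a≢c ∷ _) ∷ (b≢c ∷ _) ∷ _) (s≤s (s≤s (s≤s _))) p q
    with a ≟ᴬ p | a ≟ᴬ q | b ≟ᴬ p | b ≟ᴬ q
  ... | no a≢p   | no a≢q   | _        | _        = a , here refl , a≢p , a≢q
  ... | _        | _        | no b≢p   | no b≢q   = b , there (here refl) , b≢p , b≢q
  ... | yes refl | _        | yes refl | _        = contradiction refl a≢b
  ... | _        | yes refl | _        | yes refl = contradiction refl a≢b
  ... | yes refl | _        | _        | yes refl = c , there (there (here refl)) , ≢-sym a≢c , ≢-sym b≢c
  ... | _        | yes refl | yes refl | _        = c , there (there (here refl)) , ≢-sym b≢c , ≢-sym a≢c

∷-injective : ∀ {A : Set} {a : A} {s : Vector A k} → Injective _≡_ _≡_ s → (∀ i → a ≢ s i) →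
              Injective _≡_ _≡_ (a ∷ᵛ s)
∷-injective s-inj a∉s {zero}  {zero}  _     = refl
∷-injective s-inj a∉s {zero}  {suc j} a≡sj  = contradiction a≡sj (a∉s j)
∷-injective s-inj a∉s {suc i} {zero}  si≡a  = contradiction (sym si≡a) (a∉s i)
∷-injective s-inj a∉s {suc i} {suc j} si≡sj = cong suc (s-inj si≡sj)

outside-image : k < n → (s : Vector (Fin n) k) → ∃ λ x → ∀ i → x ≢ s i
outside-image k<n s with any? (λ x → all? λ i → ¬? (x ≟ s i))
... | yes found = found
... | no  none  = contradiction (injective⇒≤ section-injective) (ℕ.<⇒≱ k<n)
  where
  preimage : ∀ x → ∃ λ i → x ≡ s i
  preimage x with any? (λ i → x ≟ s i)
  ... | yes found = found
  ... | no  ¬found = contradiction (x , λ i x≡si → ¬found (i , x≡si)) none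

  section-injective : Injective _≡_ _≡_ (proj₁ ∘ preimage)
  section-injective {x} {y} i≡j =
    trans (proj₂ (preimage x)) (trans (cong s i≡j) (sym (proj₂ (preimage y))))

module _ {G : Graph n} where

  adj⇒≢ : adj G u v ≡ true → u ≢ v
  adj⇒≢ {u} uv refl = contradiction (trans (sym uv) (irrefl G u)) λ ()

  adj-swap : adj G u v ≡ true → adj G v u ≡ true
  adj-swap {u} {v} uv = trans (adj-sym G v u) uv

  endˡ endʳ : Edge G → Fin n
  endˡ = proj₁ ∘ proj₁
  endʳ = proj₂ ∘ proj₁

  endpoints : Edge G → Vector (Fin n) 2
  endpoints e = endˡ e ∷ᵛ endʳ e ∷ᵛ []ᵛ

  IsEnd? : (z : Fin n) (e : Edge G) → Dec (IsEnd G z e)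
  IsEnd? z e = z ≟ endˡ e ⊎-dec z ≟ endʳ e

  IsEnd-cong : ∀ {e f : Edge G} → ends G e ≡ ends G f → IsEnd G z e → IsEnd G z f
  IsEnd-cong e≡f = Sum.map (λ p → trans p (cong proj₁ e≡f)) (λ p → trans p (cong proj₂ e≡f))

  edge : adj G u v ≡ true → Edge G
  edge {u = u} {v} uv with <-cmp u v
  ... | tri< u<v _ _ = (u , v) , u<v , uv
  ... | tri≈ _ u≡v _ = contradiction u≡v (adj⇒≢ uv)
  ... | tri> _ _ v<u = (v , u) , v<u , adj-swap uv

  edge-endˡ : (uv : adj G u v ≡ true) → IsEnd G u (edge uv)
  edge-endˡ {u = u} {v} uv with <-cmp u v
  ... | tri< _ _ _ = inj₁ refl
  ... | tri≈ _ u≡v _ = contradiction u≡v (adj⇒≢ uv)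
  ... | tri> _ _ _ = inj₂ refl

  edge-endʳ : (uv : adj G u v ≡ true) → IsEnd G v (edge uv)
  edge-endʳ {u = u} {v} uv with <-cmp u v
  ... | tri< _ _ _ = inj₂ refl
  ... | tri≈ _ u≡v _ = contradiction u≡v (adj⇒≢ uv)
  ... | tri> _ _ _ = inj₁ refl

  edge-ends : (uv : adj G u v ≡ true) → IsEnd G z (edge uv) → z ≡ u ⊎ z ≡ v
  edge-ends {u = u} {v} uv z∈ with <-cmp u v
  ... | tri< _ _ _ = z∈
  ... | tri≈ _ u≡v _ = contradiction u≡v (adj⇒≢ uv)
  ... | tri> _ _ _ = Sum.swap z∈

  ∉-edge : (uv : adj G u v ≡ true) → z ≢ u → z ≢ v → ¬ IsEnd G z (edge uv)
  ∉-edge uv z≢u z≢v = [ z≢u , z≢v ]′ ∘ edge-ends uv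

  Disjoint-sym : ∀ {e f : Edge G} → Disjoint G e f → Disjoint G f e
  Disjoint-sym e∥f z z∈f z∈e = e∥f z z∈e z∈f

  Disjoint⇒ends≢ : ∀ {e f : Edge G} → Disjoint G e f → ends G e ≢ ends G f
  Disjoint⇒ends≢ {_ , _} {_ , _} e∥f refl = e∥f _ (inj₁ refl) (inj₁ refl)

  disjoint-edge : (e : Edge G) → ¬ IsEnd G u e → ¬ IsEnd G v e → (uv : adj G u v ≡ true) →
                  Disjoint G e (edge uv)
  disjoint-edge e u∉e v∉e uv z z∈e z∈uv =
    [ (λ { refl → u∉e z∈e }) , (λ { refl → v∉e z∈e }) ]′ (edge-ends uv z∈uv)

  edge-disjoint : (xy : adj G x y ≡ true) (uv : adj G u v ≡ true) →
                  u ≢ x → u ≢ y → v ≢ x → v ≢ y → Disjoint G (edge xy) (edge uv)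
  edge-disjoint xy uv u≢x u≢y v≢x v≢y =
    disjoint-edge (edge xy) (∉-edge xy u≢x u≢y) (∉-edge xy v≢x v≢y) uv

  pendant-adjacent : ∀ {e : Edge G} → ¬ IsEnd G y e → (yz : adj G y z ≡ true) → IsEnd G z e →
                     AdjEdges G (edge yz) e
  pendant-adjacent {e = e} y∉e yz z∈e =
    (λ same → y∉e (IsEnd-cong {e = edge yz} {f = e} same (edge-endˡ yz))) , _ , edge-endʳ yz , z∈e

  -- 1-nearly edge independent sets and P₃ ∪ K₂

  SamePair : (g h e f : Edge G) → Set
  SamePair g h e f =
    (ends G g ≡ ends G e × ends G h ≡ ends G f) ⊎ (ends G g ≡ ends G f × ends G h ≡ ends G e)

  pair : P₃ G → EdgeSet G
  pair record { e = e ; f = f ; e~f = e≢f , _ } = e ∷ f ∷ [] , (e≢f ∷ []) ∷ [] ∷ []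

  pair-oneNearlyIndep : (p : P₃ G) → OneNearlyIndep G (pair p)
  pair-oneNearlyIndep record { e = e ; f = f ; e~f = e~f } =
    e , f , here refl , there (here refl) , e~f , only
    where
    only : ∀ g h → g ∈ₗ e ∷ f ∷ [] → h ∈ₗ e ∷ f ∷ [] → AdjEdges G g h → SamePair g h e f
    only _ _ (here refl)         (here refl)         (g≢h , _) = contradiction refl g≢h
    only _ _ (here refl)         (there (here refl)) _         = inj₁ (refl , refl)
    only _ _ (there (here refl)) (here refl)         _         = inj₂ (refl , refl)
    only _ _ (there (here refl)) (there (here refl)) (g≢h , _) = contradiction refl g≢h

  insert : (g : Edge G) (M : EdgeSet G) → All (Disjoint G g) (proj₁ M) → EdgeSet G
  insert g (es , es-unique) g∥es =
    g ∷ es , All.map⁺ {f = ends G} (All.map (λ {h} → Disjoint⇒ends≢ {e = g} {h}) g∥es) ∷ es-unique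

  insert-oneNearlyIndep : (g : Edge G) (M : EdgeSet G) (g∥M : All (Disjoint G g) (proj₁ M)) →
                          OneNearlyIndep G M → OneNearlyIndep G (insert g M g∥M)
  insert-oneNearlyIndep g M g∥M (e , f , e∈ , f∈ , e~f , only) =
    e , f , there e∈ , there f∈ , e~f , only′
    where
    only′ : ∀ h h′ → h ∈ₗ g ∷ proj₁ M → h′ ∈ₗ g ∷ proj₁ M → AdjEdges G h h′ → SamePair h h′ e f
    only′ _ _ (here refl) (here refl) (h≢h , _)         = contradiction refl h≢h
    only′ _ _ (here refl) (there h∈)  (_ , z , zg , zh) = ⊥-elim (All.lookup g∥M h∈ z zg zh)
    only′ _ _ (there g∈)  (here refl) (_ , z , zg , zh) = ⊥-elim (All.lookup g∥M g∈ z zh zg)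
    only′ _ _ (there g∈)  (there h∈)  g~h               = only _ _ g∈ h∈ g~h

  P₃⇒oneNearlyIndep₂ : P₃ G → OneNearlyIndepOfSize G 2
  P₃⇒oneNearlyIndep₂ p = pair p , pair-oneNearlyIndep p , refl

  P₃+K₂⇒oneNearlyIndep₃ : P₃+K₂ G → OneNearlyIndepOfSize G 3
  P₃+K₂⇒oneNearlyIndep₃ p =
    insert g (pair path) g∥ef ,
    insert-oneNearlyIndep g (pair path) g∥ef (pair-oneNearlyIndep path) ,
    refl
    where
    open P₃+K₂ p
    g∥ef : All (Disjoint G g) (e ∷ f ∷ [])
    g∥ef = g∥e ∷ g∥f ∷ []

  oneNearlyIndep⇒P₃+K₂ : (M : EdgeSet G) → OneNearlyIndep G M → 3 ≤ length (proj₁ M) → P₃+K₂ G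
  oneNearlyIndep⇒P₃+K₂ (es , es-unique) (e , f , e∈ , f∈ , e~f , only) 3≤|es|
    with _ , x∈ , x≢e , x≢f ← unique⇒avoids-two (≡-dec _≟_ _≟_) es-unique
                                (subst (3 ≤_) (sym (length-map (ends G) es)) 3≤|es|)
                                (ends G e) (ends G f)
    with g , g∈ , refl ← ∈-map⁻ (ends G) x∈
    = record
      { e = e ; f = f ; g = g ; e~f = e~f
      ; g∥e = λ z zg ze → [ x≢e ∘ proj₁ , x≢f ∘ proj₁ ]′ (only g e g∈ e∈ (x≢e , z , zg , ze))
      ; g∥f = λ z zg zf → [ x≢e ∘ proj₁ , x≢f ∘ proj₁ ]′ (only g f g∈ f∈ (x≢f , z , zg , zf))
      }

  ends≢⇒new-end : (e f : Edge G) → ends G e ≢ ends G f → ∃ λ c → IsEnd G c f × ¬ IsEnd G c e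
  ends≢⇒new-end e@((a , b) , a<b , _) ((c , d) , c<d , _) e≢f with IsEnd? c e | IsEnd? d e
  ... | no c∉e          | _               = c , inj₁ refl , c∉e
  ... | yes _           | no d∉e          = d , inj₂ refl , d∉e
  ... | yes (inj₁ refl) | yes (inj₂ refl) = contradiction refl e≢f
  ... | yes (inj₁ refl) | yes (inj₁ refl) = contradiction c<d (<-irrefl refl)
  ... | yes (inj₂ refl) | yes (inj₁ refl) = contradiction a<b (<-asym c<d)
  ... | yes (inj₂ refl) | yes (inj₂ refl) = contradiction c<d (<-irrefl refl)

  endpoints-injective : (e : Edge G) → Injective _≡_ _≡_ (endpoints e)
  endpoints-injective (_ , a<b , _) =
    ∷-injective (∷-injective (λ { {()} }) λ ()) λ { zero → <⇒≢ a<b ; (suc ()) }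

  ¬IsEnd⇒≢endpoints : (e : Edge G) → ¬ IsEnd G z e → ∀ i → z ≢ endpoints e i
  ¬IsEnd⇒≢endpoints e z∉e zero       = z∉e ∘ inj₁
  ¬IsEnd⇒≢endpoints e z∉e (suc zero) = z∉e ∘ inj₂

  P₃+K₂⇒5≤n : P₃+K₂ G → 5 ≤ n
  P₃+K₂⇒5≤n p =
    let c , c∈f , c∉e = ends≢⇒new-end e f (proj₁ e~f) in injective⇒≤ (five-distinct c∈f c∉e)
    where
    open P₃+K₂ p
    five-distinct : ∀ {c} → IsEnd G c f → ¬ IsEnd G c e →
                    Injective _≡_ _≡_ (c ∷ᵛ endˡ g ∷ᵛ endʳ g ∷ᵛ endpoints e)
    five-distinct {c} c∈f c∉e =
      ∷-injective (∷-injective (∷-injective (endpoints-injective e) y≢) x≢) c≢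
      where
      y≢ : ∀ i → endʳ g ≢ endpoints e i
      y≢ = ¬IsEnd⇒≢endpoints e (g∥e _ (inj₂ refl))
      x≢ : ∀ i → endˡ g ≢ (endʳ g ∷ᵛ endpoints e) i
      x≢ zero    = <⇒≢ (proj₁ (proj₂ g))
      x≢ (suc i) = ¬IsEnd⇒≢endpoints e (g∥e _ (inj₁ refl)) i
      c≢ : ∀ i → c ≢ (endˡ g ∷ᵛ endʳ g ∷ᵛ endpoints e) i
      c≢ zero          c≡x = g∥f c (inj₁ c≡x) c∈f
      c≢ (suc zero)    c≡y = g∥f c (inj₂ c≡y) c∈f
      c≢ (suc (suc i))     = ¬IsEnd⇒≢endpoints e c∉e i

  -- Consequences of connectivity

  Reach⇒boundary-edge : {S : Fin n → Set} → Decidable S → Reach G x t → ¬ S x → S t →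
                        ∃₂ λ y z → ¬ S y × S z × adj G y z ≡ true
  Reach⇒boundary-edge S? here             x∉S t∈S = contradiction t∈S x∉S
  Reach⇒boundary-edge S? (step {v = v} xv r) x∉S t∈S with S? v
  ... | yes v∈S = _ , _ , x∉S , v∈S , xv
  ... | no  v∉S = Reach⇒boundary-edge S? r v∉S t∈S

  edge⇒P₃ : Connected G → 2 < n → adj G u v ≡ true → P₃ G
  edge⇒P₃ {u} {v} conn 2<n uv
    with x , x∉ ← outside-image 2<n (u ∷ᵛ v ∷ᵛ []ᵛ)
    with y , z , y∉ , z∈ , yz ← Reach⇒boundary-edge (λ z → IsEnd? z (edge uv)) (conn x u)
                                  (∉-edge uv (x∉ zero) (x∉ (suc zero))) (edge-endˡ uv)
    = record { e = edge yz ; f = edge uv ; e~f = pendant-adjacent {e = edge uv} y∉ yz z∈ }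

  K₂+K₂-swap : K₂+K₂ G → K₂+K₂ G
  K₂+K₂-swap (e₁ , e₂ , e₁∥e₂) = e₂ , e₁ , Disjoint-sym {e = e₁} {e₂} e₁∥e₂

  K₂+K₂-pendant : ((e₁ , e₂ , _) : K₂+K₂ G) → ¬ IsEnd G y e₁ → ¬ IsEnd G y e₂ →
                  (yz : adj G y z ≡ true) → IsEnd G z e₁ → P₃+K₂ G
  K₂+K₂-pendant (e₁ , e₂ , e₁∥e₂) y∉e₁ y∉e₂ yz z∈e₁ = record
    { e = edge yz ; f = e₁ ; g = e₂
    ; e~f = pendant-adjacent {e = e₁} y∉e₁ yz z∈e₁
    ; g∥e = disjoint-edge e₂ y∉e₂ (e₁∥e₂ _ z∈e₁) yz
    ; g∥f = Disjoint-sym {e = e₁} {e₂} e₁∥e₂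
    }

  K₂+K₂⇒P₃+K₂ : Connected G → 4 < n → K₂+K₂ G → P₃+K₂ G
  K₂+K₂⇒P₃+K₂ conn 4<n M@(e₁ , e₂ , _)
    with x , x∉ ← outside-image 4<n (endˡ e₁ ∷ᵛ endʳ e₁ ∷ᵛ endˡ e₂ ∷ᵛ endʳ e₂ ∷ᵛ []ᵛ)
    with Reach⇒boundary-edge (λ z → IsEnd? z e₁ ⊎-dec IsEnd? z e₂) (conn x (endˡ e₁))
           [ [ x∉ (# 0) , x∉ (# 1) ]′ , [ x∉ (# 2) , x∉ (# 3) ]′ ]′ (inj₁ (inj₁ refl))
  ... | _ , _ , y∉ , inj₁ z∈e₁ , yz = K₂+K₂-pendant M (y∉ ∘ inj₁) (y∉ ∘ inj₂) yz z∈e₁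
  ... | _ , _ , y∉ , inj₂ z∈e₂ , yz = K₂+K₂-pendant (K₂+K₂-swap M) (y∉ ∘ inj₂) (y∉ ∘ inj₁) yz z∈e₂

  rotate : Triangle G → Triangle G
  rotate (triangle ab bc ca) = triangle bc ca ab

  triangle-pendant : (T : Triangle G) → adj G y (Triangle.a T) ≡ true →
                     y ≢ Triangle.b T → y ≢ Triangle.c T → K₂+K₂ G
  triangle-pendant (triangle ab bc ca) ya y≢b y≢c =
    edge ya , edge bc , edge-disjoint ya bc (≢-sym y≢b) (≢-sym (adj⇒≢ ab)) (≢-sym y≢c) (adj⇒≢ ca)

  triangle⇒K₂+K₂ : Connected G → 3 < n → Triangle G → K₂+K₂ G
  triangle⇒K₂+K₂ conn 3<n T@(triangle {a} {b} {c} _ _ _)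
    with x , x∉ ← outside-image 3<n (a ∷ᵛ b ∷ᵛ c ∷ᵛ []ᵛ)
    with Reach⇒boundary-edge (λ z → z ≟ a ⊎-dec z ≟ b ⊎-dec z ≟ c) (conn x a)
           [ x∉ (# 0) , [ x∉ (# 1) , x∉ (# 2) ]′ ]′ (inj₁ refl)
  ... | _ , _ , y∉ , inj₁ refl , yz =
    triangle-pendant T yz (y∉ ∘ inj₂ ∘ inj₁) (y∉ ∘ inj₂ ∘ inj₂)
  ... | _ , _ , y∉ , inj₂ (inj₁ refl) , yz =
    triangle-pendant (rotate T) yz (y∉ ∘ inj₂ ∘ inj₂) (y∉ ∘ inj₁)
  ... | _ , _ , y∉ , inj₂ (inj₂ refl) , yz =
    triangle-pendant (rotate (rotate T)) yz (y∉ ∘ inj₁) (y∉ ∘ inj₂ ∘ inj₁)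

  K₂+K₂-or-incident : adj G u v ≡ true → AvoidingEdge G u →
                      K₂+K₂ G ⊎ ∃ λ w → adj G v w ≡ true × w ≢ u
  K₂+K₂-or-incident {u} {v} uv (p , q , pq , p≢u , q≢u) with p ≟ v | q ≟ v
  ... | yes refl | _        = inj₂ (q , pq , q≢u)
  ... | no _     | yes refl = inj₂ (p , adj-swap pq , p≢u)
  ... | no p≢v   | no q≢v   =
    inj₁ (edge uv , edge pq , edge-disjoint uv pq p≢u p≢v q≢u q≢v)

  K₂+K₂⊎Triangle : adj G u v ≡ true → AvoidingEdge G u → AvoidingEdge G v → K₂+K₂ G ⊎ Triangle G
  K₂+K₂⊎Triangle {u} {v} uv avoid-u avoid-v with K₂+K₂-or-incident uv avoid-u
  ... | inj₁ M = inj₁ M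
  ... | inj₂ (w , vw , w≢u) with K₂+K₂-or-incident (adj-swap uv) avoid-v
  ...   | inj₁ M = inj₁ M
  ...   | inj₂ (s , us , s≢v) with s ≟ w
  ...     | yes refl = inj₂ (triangle uv vw (adj-swap us))
  ...     | no s≢w   =
    inj₁ (edge us , edge vw , edge-disjoint us vw (≢-sym (adj⇒≢ uv)) (≢-sym s≢v) w≢u (≢-sym s≢w))

  -- Vertices meeting every edge

  meets? : Decidable (MeetsEveryEdge G)
  meets? c = all? λ i → all? λ j → (adj G i j Bool.≟ true) →-dec (i ≟ c ⊎-dec j ≟ c)

  ¬meets⇒avoiding : ∀ {c} → ¬ MeetsEveryEdge G c → AvoidingEdge G c
  ¬meets⇒avoiding {c} ¬meets
    with any? (λ i → any? λ j → (adj G i j Bool.≟ true) ×-dec ¬? (i ≟ c) ×-dec ¬? (j ≟ c))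
  ... | yes (i , found) = i , found
  ... | no  none        = contradiction meets ¬meets
    where
    meets : MeetsEveryEdge G c
    meets i j ij with i ≟ c | j ≟ c
    ... | yes i≡c | _       = inj₁ i≡c
    ... | no _    | yes j≡c = inj₂ j≡c
    ... | no i≢c  | no j≢c  = contradiction (i , j , ij , i≢c , j≢c) none

  meets⇒IsEnd : ∀ {c} → MeetsEveryEdge G c → (e : Edge G) → IsEnd G c e
  meets⇒IsEnd meets ((a , b) , _ , ab) = Sum.map sym sym (meets a b ab)

  P₃+K₂⇒¬meets : ∀ {c} → P₃+K₂ G → ¬ MeetsEveryEdge G c
  P₃+K₂⇒¬meets p meets = g∥f _ (meets⇒IsEnd meets g) (meets⇒IsEnd meets f)
    where open P₃+K₂ p

  connected⇒dominating : ∀ {c} → Connected G → MeetsEveryEdge G c → Dominating G c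
  connected⇒dominating {c} conn meets j j≢c with conn j c
  ... | here = contradiction refl j≢c
  ... | step {v = v} jv _ with meets j v jv
  ...   | inj₁ j≡c  = contradiction j≡c j≢c
  ...   | inj₂ refl = adj-swap jv

Iso-meets : {G : Graph n} {H : Graph m} → Iso G H → ∃ (MeetsEveryEdge H) → ∃ (MeetsEveryEdge G)
Iso-meets {G = G} {H} (π , pres) (d , meets) =
  Inverse.from π d , λ i j ij → Sum.map pull pull (meets _ _ (trans (sym (pres i j)) ij))
  where
  pull : Inverse.to π x ≡ d → x ≡ Inverse.from π d
  pull = sym ∘ Inverse.inverseʳ π ∘ sym

centred-transport : {G : Graph n} {H : Graph m} {c : Fin n} {d : Fin m} →
                    MeetsEveryEdge G c → Dominating H d → (π : Fin n ↔ Fin m) → Inverse.to π c ≡ d →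
                    adj G u v ≡ true → adj H (Inverse.to π u) (Inverse.to π v) ≡ true
centred-transport {u = u} {v = v} {G = G} {H} meets dom π refl uv with meets u v uv
... | inj₁ refl = dom _ (adj⇒≢ {G = G} uv ∘ sym ∘ Injection.injective (↔⇒↣ π))
... | inj₂ refl = adj-swap {G = H} (dom _ (adj⇒≢ {G = G} uv ∘ Injection.injective (↔⇒↣ π)))

centred-Iso : {G : Graph n} {H : Graph m} {c : Fin n} {d : Fin m} →
              MeetsEveryEdge G c → Dominating G c → MeetsEveryEdge H d → Dominating H d →
              (π : Fin n ↔ Fin m) → Inverse.to π c ≡ d → Iso G H
centred-Iso {G = G} {H} {c} {d} meetsG domG meetsH domH π πc≡d =
  π , λ i j → Bool.⇔→≡ (mk⇔ (centred-transport {G = G} {H} {c} {d} meetsG domH π πc≡d) (back i j))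
  where
  back : ∀ i j → adj H (Inverse.to π i) (Inverse.to π j) ≡ true → adj G i j ≡ true
  back i j =
    subst₂ (λ a b → adj G a b ≡ true) (Inverse.strictlyInverseʳ π i) (Inverse.strictlyInverseʳ π j)
    ∘ centred-transport {G = H} {G} {d} {c} meetsH domG (↔-sym π) (Inverse.inverseʳ π (sym πc≡d))

-- `Star (suc m)` is `fromEdges (spokes (allFin m))`, whose adjacency tests membership of the
-- pair in `spokes (allFin m)` in both orders.
spokes : List (Fin m) → List (Fin (suc m) × Fin (suc m))
spokes = map (λ k → zero , suc k)

any-spokes-from-leaf : ∀ (i : Fin m) (p : Fin (suc m) → Bool) xs →
                     any (λ e → ⌊ suc i ≟ proj₁ e ⌋ ∧ p (proj₂ e)) (spokes xs) ≡ false
any-spokes-from-leaf i p []       = refl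
any-spokes-from-leaf i p (_ ∷ xs) = any-spokes-from-leaf i p xs

isYes-refl : (i : Fin n) → ⌊ i ≟ i ⌋ ≡ true
isYes-refl i with i ≟ i
... | yes _   = refl
... | no  i≢i = contradiction refl i≢i

any-spokes-to : ∀ (j : Fin m) xs → j ∈ₗ xs →
               any (λ e → ⌊ zero ≟ proj₁ e ⌋ ∧ ⌊ suc j ≟ proj₂ e ⌋) (spokes xs) ≡ true
any-spokes-to j (_ ∷ _)  (here refl) rewrite isYes-refl (suc j) = refl
any-spokes-to j (_ ∷ xs) (there j∈) =
  trans (cong₂ _∨_ refl (any-spokes-to j xs j∈)) (Bool.∨-zeroʳ _)

Star-adj-leaves : ∀ (i j : Fin m) → adj (Star (suc m)) (suc i) (suc j) ≡ false
Star-adj-leaves {m} i j =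
  trans (cong₂ _∧_ refl (cong₂ _∨_ (any-spokes-from-leaf i _ (allFin m)) (any-spokes-from-leaf j _ (allFin m))))
        (Bool.∧-zeroʳ _)

Star-adj-centre : ∀ (j : Fin m) → adj (Star (suc m)) zero (suc j) ≡ true
Star-adj-centre j = cong₂ _∨_ (any-spokes-to j _ (∈-allFin j)) refl

Star-meets : MeetsEveryEdge (Star (suc m)) zero
Star-meets zero    _       _  = inj₁ refl
Star-meets (suc _) zero    _  = inj₂ refl
Star-meets (suc i) (suc j) ij = contradiction (trans (sym ij) (Star-adj-leaves i j)) λ ()

Star-dominating : Dominating (Star (suc m)) zero
Star-dominating zero    0≢0 = contradiction refl 0≢0
Star-dominating (suc j) _   = Star-adj-centre j

transpose-to : (i j : Fin n) → Perm.transpose i j ⟨$⟩ʳ i ≡ j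
transpose-to i j with i ≟ i
... | yes _   = refl
... | no  i≢i = contradiction refl i≢i

centre⇒Iso-Star : {G : Graph (suc m)} {c : Fin (suc m)} →
                  Connected G → MeetsEveryEdge G c → Iso G (Star (suc m))
centre⇒Iso-Star {m = m} {G = G} {c = c} conn meets =
  centred-Iso {G = G} {Star (suc m)} {c} {zero} meets (connected⇒dominating conn meets)
              Star-meets Star-dominating (Perm.transpose c zero) (transpose-to c zero)

P₃+K₂⇒¬Iso-Star : {G : Graph n} → P₃+K₂ G → ¬ Iso G (Star n)
P₃+K₂⇒¬Iso-Star {zero}  p = ⊥-elim (¬Fin0 (proj₁ (proj₁ (P₃+K₂.g p))))
P₃+K₂⇒¬Iso-Star {suc n} {G} p iso =
  P₃+K₂⇒¬meets p (proj₂ (Iso-meets {G = G} {H = Star (suc n)} iso (zero , Star-meets)))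

-- Connected graphs on few vertices, by exhaustive search

_≐_ : Graph n → Graph n → Set
G ≐ H = ∀ i j → adj G i j ≡ adj H i j

module ≐-Transfer {G H : Graph n} (G≐H : G ≐ H) where

  Reach-≐ : Reach G u v → Reach H u v
  Reach-≐ here                     = here
  Reach-≐ (step {u} {v} uv reach) = step (trans (sym (G≐H u v)) uv) (Reach-≐ reach)

  Iso-≐ : {K : Graph m} → Iso H K → Iso G K
  Iso-≐ (π , pres) = π , λ i j → trans (G≐H i j) (pres i j)

  Exceptional-≐ : Exceptional H → Exceptional G
  Exceptional-≐ =
    Sum.map (Iso-≐ {K = C₃}) (Sum.map (Iso-≐ {K = C₄}) (Sum.map (Iso-≐ {K = D₄})
      (Sum.map (Iso-≐ {K = K₄}) (Sum.map (Iso-≐ {K = U₁₃}) (Sum.map (Iso-≐ {K = P₄}) (Iso-≐ {K = Star n}))))))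

Code : ℕ → Set
Code zero    = ⊤
Code (suc n) = Subset n × Code n

decode-adj : Code n → Fin n → Fin n → Bool
decode-adj {suc n} _       zero    zero    = false
decode-adj {suc n} (s , _) zero    (suc j) = lookup s j
decode-adj {suc n} (s , _) (suc i) zero    = lookup s i
decode-adj {suc n} (_ , c) (suc i) (suc j) = decode-adj c i j

decode-adj-sym : (c : Code n) → ∀ i j → decode-adj c i j ≡ decode-adj c j i
decode-adj-sym {suc n} _       zero    zero    = refl
decode-adj-sym {suc n} _       zero    (suc j) = refl
decode-adj-sym {suc n} _       (suc i) zero    = refl
decode-adj-sym {suc n} (_ , c) (suc i) (suc j) = decode-adj-sym c i j

decode-adj-irrefl : (c : Code n) → ∀ i → decode-adj c i i ≡ false
decode-adj-irrefl {suc n} _       zero    = refl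
decode-adj-irrefl {suc n} (_ , c) (suc i) = decode-adj-irrefl c i

decode : Code n → Graph n
decode c = record { adj = decode-adj c ; adj-sym = decode-adj-sym c ; irrefl = decode-adj-irrefl c }

delete-zero : Graph (suc n) → Graph n
delete-zero G = record
  { adj     = λ i j → adj G (suc i) (suc j)
  ; adj-sym = λ i j → adj-sym G (suc i) (suc j)
  ; irrefl  = irrefl G ∘ suc
  }

encode : Graph n → Code n
encode {zero}  G = tt
encode {suc n} G = tabulate (adj G zero ∘ suc) , encode (delete-zero G)

decode-encode : (G : Graph n) → decode (encode G) ≐ G
decode-encode {suc n} G zero    zero    = sym (irrefl G zero)
decode-encode {suc n} G zero    (suc j) = lookup∘tabulate _ j
decode-encode {suc n} G (suc i) zero    = trans (lookup∘tabulate _ i) (adj-sym G zero (suc i))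
decode-encode {suc n} G (suc i) (suc j) = decode-encode (delete-zero G) i j

∀-Subset? : {P : Subset n → Set} → Decidable P → Dec (∀ s → P s)
∀-Subset? P? = map′ (λ ¬∃¬P s → decidable-stable (P? s) (λ ¬Ps → ¬∃¬P (s , ¬Ps)))
                    (λ ∀P (s , ¬Ps) → ¬Ps (∀P s))
                    (¬? (anySubset? (¬? ∘ P?)))

∀-Code? : {P : Code n → Set} → Decidable P → Dec (∀ c → P c)
∀-Code? {zero}  P? = map′ const (_$ tt) (P? tt)
∀-Code? {suc n} P? = map′ (λ ∀P (s , c) → ∀P s c) (λ ∀P s c → ∀P (s , c))
                          (∀-Subset? λ s → ∀-Code? λ c → P? (s , c))

permutations : ∀ n → List (Permutation′ n)
permutations zero    = Perm.id ∷ []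
permutations (suc n) = concatMap (λ i → map (Perm.insert zero i) (permutations n)) (allFin (suc n))

iso? : (G : Graph n) (H : Graph m) → Maybe (Iso G H)
iso? {n} {m} G H with n ℕ.≟ m
... | no  _    = nothing
... | yes refl =
  head (mapMaybe (λ π → Maybe.map (π ,_) (dec⇒maybe (preserves? π))) (permutations n))
  where
  preserves? : (π : Permutation′ n) → Dec (∀ i j → adj G i j ≡ adj H (π ⟨$⟩ʳ i) (π ⟨$⟩ʳ j))
  preserves? π = all? λ i → all? λ j → adj G i j Bool.≟ adj H (π ⟨$⟩ʳ i) (π ⟨$⟩ʳ j)

Closed : Graph n → Subset n → Set
Closed G S = ∀ u v → adj G u v ≡ true → u ∈ S → v ∈ S

Reach-closed : {G : Graph n} {S : Subset n} → Closed G S → Reach G u v → u ∈ S → v ∈ S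
Reach-closed S-closed here              u∈S = u∈S
Reach-closed S-closed (step {u} {v} uv r) u∈S = Reach-closed S-closed r (S-closed u v uv u∈S)

disconnected? : (G : Graph n) → Maybe (¬ Connected G)
disconnected? G =
  Maybe.map separates
    (dec⇒maybe (anySubset? λ S → closed? S ×-dec any? (_∈? S) ×-dec any? (λ v → ¬? (v ∈? S))))
  where
  closed? : (S : Subset _) → Dec (Closed G S)
  closed? S = all? λ u → all? λ v → (adj G u v Bool.≟ true) →-dec (u ∈? S →-dec v ∈? S)
  separates : ∃ (λ S → Closed G S × (∃ λ u → u ∈ S) × (∃ λ v → v ∉ S)) → ¬ Connected G
  separates (_ , S-closed , (u , u∈S) , (v , v∉S)) conn = v∉S (Reach-closed S-closed (conn u v) u∈S)

_<⊎>_ : ∀ {A B : Set} → Maybe A → Maybe B → Maybe (A ⊎ B)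
a <⊎> b = Maybe.map inj₁ a <∣> Maybe.map inj₂ b

infixr 4 _<⊎>_

exceptional? : (G : Graph n) → Maybe (Exceptional G)
exceptional? {n} G =
  iso? G C₃ <⊎> iso? G C₄ <⊎> iso? G D₄ <⊎> iso? G K₄ <⊎> iso? G U₁₃ <⊎> iso? G P₄ <⊎> iso? G (Star n)

classify : (G : Graph n) → Maybe (Connected G → Exceptional G)
classify G =
  Maybe.map const (exceptional? G)
  <∣> Maybe.map (λ ¬conn conn → contradiction conn ¬conn) (disconnected? G)

-- For a concrete n, the hypothesis is discharged by `tt` exactly when the type checker, running
-- `classify` on every code, finds each graph on n vertices disconnected or exceptional.
connected⇒exceptional : ∀ n → True (∀-Code? {n} λ c → Bool.T? (is-just (classify (decode c)))) →
                        (G : Graph n) → Connected G → Exceptional G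
connected⇒exceptional n all-classified G conn =
  Exceptional-≐ (to-witness-T _ (toWitness all-classified (encode G)) (Reach-≐ ∘₂ conn))
  where open ≐-Transfer {G = G} {H = decode (encode G)} (sym ∘₂ decode-encode G)

module IsAlpha1'-Properties {G : Graph n} (α : IsAlpha1' G k) where

  maximum : OneNearlyIndepOfSize G m → m ≤ k
  maximum (M , M-ind , refl) =
    [ (λ (_ , maximal) → maximal M M-ind) , (λ (none , _) → contradiction M-ind (none M)) ]′ α

  P₃+K₂⇒3≤k : P₃+K₂ G → 3 ≤ k
  P₃+K₂⇒3≤k = maximum ∘ P₃+K₂⇒oneNearlyIndep₃

  3≤k⇒P₃+K₂ : 3 ≤ k → P₃+K₂ G
  3≤k⇒P₃+K₂ 3≤k =
    [ (λ ((M , M-ind , |M|≡k) , _) → oneNearlyIndep⇒P₃+K₂ M M-ind (subst (3 ≤_) (sym |M|≡k) 3≤k))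
    , (λ (_ , k≡0) → contradiction (subst (3 ≤_) k≡0 3≤k) λ ()) ]′ α

Exceptional⇒P₃+K₂-free : {G : Graph n} → Exceptional G → ¬ P₃+K₂ G
Exceptional⇒P₃+K₂-free {G = G} exceptional p =
  [ small C₃ (ℕ.n≤1+n 3) , [ small C₄ ℕ.≤-refl , [ small D₄ ℕ.≤-refl , [ small K₄ ℕ.≤-refl ,
  [ small U₁₃ ℕ.≤-refl , [ small P₄ ℕ.≤-refl , P₃+K₂⇒¬Iso-Star p ]′ ]′ ]′ ]′ ]′ ]′ exceptional
  where
  small : (H : Graph m) → m ≤ 4 → ¬ Iso G H
  small _ m≤4 (π , _) = ℕ.≤⇒≯ (subst (_≤ 4) (sym (Perm.↔⇒≡ π)) m≤4) (P₃+K₂⇒5≤n p)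

some-edge : {G : Graph (2 + n)} → Connected G → ∃₂ λ u v → adj G u v ≡ true
some-edge conn with conn zero (suc zero)
... | step uv _ = _ , _ , uv

connected⇒P₃ : {G : Graph (3 + n)} → Connected G → P₃ G
connected⇒P₃ conn = let _ , _ , uv = some-edge conn in edge⇒P₃ conn (s≤s (s≤s (s≤s z≤n))) uv

P₃+K₂-free⇒Exceptional : {G : Graph (3 + n)} → Connected G → ¬ P₃+K₂ G → Exceptional G
P₃+K₂-free⇒Exceptional {zero}        {G} conn _ = connected⇒exceptional 3 tt G conn
P₃+K₂-free⇒Exceptional {suc zero}    {G} conn _ = connected⇒exceptional 4 tt G conn
P₃+K₂-free⇒Exceptional {suc (suc n)} {G} conn free with any? (meets? {G = G})
... | yes (c , meets) = inj₂ (inj₂ (inj₂ (inj₂ (inj₂ (inj₂ (centre⇒Iso-Star conn meets))))))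
... | no  no-centre   = contradiction (K₂+K₂⇒P₃+K₂ conn 4<5+n (K₂+K₂-from-edge (some-edge conn))) free
  where
  4<5+n : 4 < 5 + n
  4<5+n = s≤s (s≤s (s≤s (s≤s (s≤s z≤n))))

  avoiding : ∀ c → AvoidingEdge G c
  avoiding c = ¬meets⇒avoiding {G = G} (no-centre ∘ (c ,_))

  K₂+K₂-from-edge : (∃₂ λ u v → adj G u v ≡ true) → K₂+K₂ G
  K₂+K₂-from-edge (u , v , uv) =
    [ id , triangle⇒K₂+K₂ conn (ℕ.<-trans (ℕ.n<1+n 3) 4<5+n) ]′
      (K₂+K₂⊎Triangle uv (avoiding u) (avoiding v))

theorem3p3 : (n : ℕ) → 3 ≤ n → (G : Graph n) → Connected G → (k : ℕ) → IsAlpha1' G k →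
    (2 ≤ k) × ((k ≡ 2) ⇔ (Iso G C₃ ⊎ Iso G C₄ ⊎ Iso G D₄ ⊎ Iso G K₄ ⊎ Iso G U₁₃ ⊎ Iso G P₄ ⊎ Iso G (Star n)))
theorem3p3 _ (s≤s (s≤s (s≤s _))) G conn k α = 2≤k , mk⇔ k≡2⇒exceptional exceptional⇒k≡2
  where
  open IsAlpha1'-Properties {G = G} α

  2≤k : 2 ≤ k
  2≤k = maximum (P₃⇒oneNearlyIndep₂ (connected⇒P₃ conn))

  k≡2⇒exceptional : k ≡ 2 → Exceptional G
  k≡2⇒exceptional refl = P₃+K₂-free⇒Exceptional conn (ℕ.<-irrefl refl ∘ P₃+K₂⇒3≤k)

  exceptional⇒k≡2 : Exceptional G → k ≡ 2
  exceptional⇒k≡2 exceptional =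
    ℕ.≤-antisym (ℕ.≮⇒≥ (Exceptional⇒P₃+K₂-free exceptional ∘ 3≤k⇒P₃+K₂)) 2≤k
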